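{- (1) If $\langle R,\circ,e,-\rangle$ is an Abelian group (with $-x$ the inverse of $x$), then $\langle R,\circ,e,-,e\rangle$ is a CBI-model, where $\circ$ is viewed as the relation $x\circ y=\{x\cdot y\}$. (2) Conversely, if $\langle R,\circ,e,-,\infty\rangle$ is a CBI-model in which $x\circ y$ has at most one element for all $x,y$ (so $\circ$ is a partial function) and $\infty=e$, then $\circ$ is total and $\langle R,\circ,e,-\rangle$ is an Abelian group.
   Context: A BBI-model is $\langle R,\circ,e\rangle$ with $e\in R$, $\circ:R\times R\to\mathcal{P}(R)$ commutative and associative (w.r.t. the pointwise extension $X\circ Y=\bigcup_{x\in X,y\in Y}x\circ y$) with $r\circ e=\{r\}$ for all $r$. A CBI-model is $\langle R,\circ,e,-,\infty\rangle$ with $\langle R,\circ,e\rangle$ a BBI-model, $-:R\to R$, $\infty\in R$, such that for each $x$, $-x$ is the unique element with $\infty\in x\circ(-x)$. When $|x\circ y|\le 1$ for all $x,y$, $\circ$ is identified with a partial function $R\times R\rightharpoonup R$; it is total if $x\circ y\neq\emptyset$ always. -}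

module Defs where

open import Level using (Level; _⊔_; suc)
open import Data.Product using (Σ; ∃; _×_; _,_)
open import Relation.Binary.PropositionalEquality using (_≡_)
open import Function.Bundles using (_⇔_)

-- A multiplicative relation  ∘ : R × R → P(R)  is represented by its
-- membership predicate:  Op R  with  (_∘_∋_) x y z  meaning  z ∈ x ∘ y.
Op : ∀ {a} → Set a → Set (suc a)
Op {a} R = R → R → R → Set a

module _ {a : Level} {R : Set a} (_∘_∋_ : Op R) where

  Commutative : Set a
  Commutative = ∀ x y w → ((x ∘ y ∋ w) ⇔ (y ∘ x ∋ w))

  Associative : Set a
  Associative = ∀ x y z w →
    ((∃ λ u → (x ∘ y ∋ u) × (u ∘ z ∋ w)) ⇔ (∃ λ v → (y ∘ z ∋ v) × (x ∘ v ∋ w)))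

  Unit : R → Set a
  Unit e = ∀ r w → ((r ∘ e ∋ w) ⇔ (w ≡ r))

  PartialFunctional : Set a
  PartialFunctional = ∀ x y z z' → (x ∘ y ∋ z) → (x ∘ y ∋ z') → z ≡ z'

  Total : Set a
  Total = ∀ x y → ∃ λ z → x ∘ y ∋ z

record IsBBIModel {a : Level} {R : Set a} (_∘_∋_ : Op R) (e : R) : Set a where
  field
    comm  : Commutative _∘_∋_
    assoc : Associative _∘_∋_
    unit  : Unit _∘_∋_ e

record IsCBIModel {a : Level} {R : Set a} (_∘_∋_ : Op R) (e : R)
                  (-_ : R → R) (∞ : R) : Set a where
  field
    isBBIModel : IsBBIModel _∘_∋_ e
    inv-mem    : ∀ x → x ∘ (- x) ∋ ∞
    inv-unique : ∀ x y → x ∘ y ∋ ∞ → y ≡ - x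

graph : ∀ {a} {R : Set a} → (R → R → R) → Op R
graph _·_ x y z = z ≡ x · y

-- (1) The laws of BBI-models (commutativity, associativity, unit) are set
--     versions of the monoid laws, so the graph of a commutative monoid
--     operation is a BBI-model ('graph-isBBIModel').  In a group, x · y = e
--     holds exactly for y = x⁻¹, which is the CBI condition with ∞ = e.
-- (2) Conversely, in a BBI-model where every x has some y with e ∈ x ∘ y,
--     x ∘ y is never empty: y ∈ y ∘ e ⊆ y ∘ (x ∘ x') = (y ∘ x) ∘ x'
--     ('invertible⇒total').  A total, partial-functional relation is the
--     graph of a function, and the BBI laws of the relation become the
--     monoid laws of that function ('FunctionalRelation').  In a CBI-model
--     with ∞ = e we have e ∈ x ∘ (- x), so both steps apply and give an
--     Abelian group.
module Submission where

open import Defs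
open import Level using (Level)
open import Data.Product using (Σ; proj₁; proj₂; _×_; _,_; ∃)
open import Relation.Binary.PropositionalEquality
  using (_≡_; refl; sym; trans; cong; cong₂; subst; isEquivalence)
open import Function.Bundles using (mk⇔; Equivalence)
open import Algebra.Structures using (IsAbelianGroup; IsCommutativeMonoid)
import Algebra.Definitions as Law
import Algebra.Consequences.Propositional as Consequences

module Graph {a : Level} {R : Set a} (_·_ : R → R → R) where

  graph-comm : Law.Commutative _≡_ _·_ → Commutative (graph _·_)
  graph-comm ·-comm x y w =
    mk⇔ (λ w≡xy → trans w≡xy (·-comm x y)) (λ w≡yx → trans w≡yx (·-comm y x))

  -- An associative operation has a graph associative in the pointwise sense:
  -- both sides of the BBI associativity law are {(x · y) · z} = {x · (y · z)}.
  graph-assoc : Law.Associative _≡_ _·_ → Associative (graph _·_)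
  graph-assoc ·-assoc x y z w = mk⇔
    (λ { (_ , refl , refl) → y · z , refl , ·-assoc x y z })
    (λ { (_ , refl , refl) → x · y , refl , sym (·-assoc x y z) })

  graph-unit : ∀ {e} → Law.RightIdentity _≡_ e _·_ → Unit (graph _·_) e
  graph-unit identityʳ r w =
    mk⇔ (λ w≡re → trans w≡re (identityʳ r)) (λ w≡r → trans w≡r (sym (identityʳ r)))

  graph-isBBIModel : ∀ {e} → IsCommutativeMonoid _≡_ _·_ e → IsBBIModel (graph _·_) e
  graph-isBBIModel M = record
    { comm  = graph-comm comm
    ; assoc = graph-assoc assoc
    ; unit  = graph-unit identityʳ
    }
    where open IsCommutativeMonoid M using (comm; assoc; identityʳ)

  abelianGroup⇒CBIModel : ∀ {e -_} → IsAbelianGroup _≡_ _·_ e -_ →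
                          IsCBIModel (graph _·_) e -_ e
  abelianGroup⇒CBIModel G = record
    { isBBIModel = graph-isBBIModel isCommutativeMonoid
    ; inv-mem    = λ x → sym (inverseʳ x)
    ; inv-unique = λ x y e≡xy →
        Consequences.assoc∧id∧invˡ⇒invʳ-unique assoc identity inverseˡ x y (sym e≡xy)
    }
    where open IsAbelianGroup G
            using (isCommutativeMonoid; inverseʳ; inverseˡ; assoc; identity)

module _ {a : Level} {R : Set a} {_∘_∋_ : Op R} {e : R}
         (bbi : IsBBIModel _∘_∋_ e) where
  open IsBBIModel bbi

  unit-member : ∀ r → r ∘ e ∋ r
  unit-member r = Equivalence.from (unit r r) refl

  -- If e ∈ x ∘ x', then y ∈ y ∘ (x ∘ x') = (y ∘ x) ∘ x', so y ∘ x ≠ ∅.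
  invertible⇒total : (∀ x → ∃ λ x' → x ∘ x' ∋ e) → Total _∘_∋_
  invertible⇒total invertible x y =
    let (x' , xx'∋e) = invertible x
        (u , yx∋u , _) = Equivalence.from (assoc y x x' y) (e , xx'∋e , unit-member y)
    in u , Equivalence.to (comm y x u) yx∋u

module FunctionalRelation {a : Level} {R : Set a} {_∘_∋_ : Op R}
                          (functional : PartialFunctional _∘_∋_)
                          (total : Total _∘_∋_) where

  _·_ : R → R → R
  x · y = proj₁ (total x y)

  ·-member : ∀ x y → x ∘ y ∋ (x · y)
  ·-member x y = proj₂ (total x y)

  member⇒≡· : ∀ {x y z} → x ∘ y ∋ z → z ≡ x · y
  member⇒≡· {x} {y} xy∋z = functional x y _ _ xy∋z (·-member x y)

  ·-comm : Commutative _∘_∋_ → Law.Commutative _≡_ _·_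
  ·-comm comm x y = member⇒≡· (Equivalence.from (comm y x (x · y)) (·-member x y))

  -- (x · y) · z ∈ (x ∘ y) ∘ z = x ∘ (y ∘ z) = x ∘ {y · z}.
  ·-assoc : Associative _∘_∋_ → Law.Associative _≡_ _·_
  ·-assoc assoc x y z =
    let (v , yz∋v , xv∋xyz) =
          Equivalence.to (assoc x y z ((x · y) · z)) (x · y , ·-member x y , ·-member (x · y) z)
    in trans (member⇒≡· xv∋xyz) (cong (x ·_) (member⇒≡· yz∋v))

  ·-identityʳ : ∀ {e} → Unit _∘_∋_ e → Law.RightIdentity _≡_ e _·_
  ·-identityʳ unit x = Equivalence.to (unit x (x · _)) (·-member x _)

  ·-inverseʳ : ∀ {e -_} → (∀ x → x ∘ (- x) ∋ e) → Law.RightInverse _≡_ e -_ _·_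
  ·-inverseʳ inv x = sym (member⇒≡· (inv x))

  ·-isAbelianGroup : ∀ {e -_} → IsBBIModel _∘_∋_ e → (∀ x → x ∘ (- x) ∋ e) →
                     IsAbelianGroup _≡_ _·_ e -_
  ·-isAbelianGroup bbi inv = record
    { isGroup = record
      { isMonoid = record
        { isSemigroup = record
          { isMagma = record { isEquivalence = isEquivalence ; ∙-cong = cong₂ _·_ }
          ; assoc = ·-assoc assoc
          }
        ; identity = Consequences.comm∧idʳ⇒id ·-comm′ (·-identityʳ unit)
        }
      ; inverse = Consequences.comm∧invʳ⇒inv ·-comm′ (·-inverseʳ inv)
      ; ⁻¹-cong = λ { refl → refl }
      }
    ; comm = ·-comm′
    }
    where
      open IsBBIModel bbi using (comm; assoc; unit)
      ·-comm′ : Law.Commutative _≡_ _·_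
      ·-comm′ = ·-comm comm

functionalCBIModel⇒abelianGroup :
  ∀ {a : Level} {R : Set a} (_∘_∋_ : Op R) (e : R) (-_ : R → R) (∞ : R) →
  IsCBIModel _∘_∋_ e -_ ∞ → PartialFunctional _∘_∋_ → ∞ ≡ e →
  Σ (Total _∘_∋_) λ tot → IsAbelianGroup _≡_ (λ x y → proj₁ (tot x y)) e -_
functionalCBIModel⇒abelianGroup _∘_∋_ e -_ ∞ cbi functional ∞≡e =
  total , FunctionalRelation.·-isAbelianGroup functional total isBBIModel inverse-e
  where
    open IsCBIModel cbi
    inverse-e : ∀ x → x ∘ (- x) ∋ e
    inverse-e x = subst (x ∘ (- x) ∋_) ∞≡e (inv-mem x)
    total : Total _∘_∋_
    total = invertible⇒total isBBIModel (λ x → - x , inverse-e x)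

proposition5p1 : ∀ {a : Level} {R : Set a}
    → ((_·_ : R → R → R) (e : R) (-_ : R → R)
        → IsAbelianGroup _≡_ _·_ e -_
        → IsCBIModel (graph _·_) e -_ e)
    × ((_∘_∋_ : Op R) (e : R) (-_ : R → R) (∞ : R)
        → IsCBIModel _∘_∋_ e -_ ∞
        → PartialFunctional _∘_∋_
        → ∞ ≡ e
        → Σ (Total _∘_∋_) λ tot →
            IsAbelianGroup _≡_ (λ x y → proj₁ (tot x y)) e -_)
proposition5p1 =
  (λ _·_ e -_ → Graph.abelianGroup⇒CBIModel _·_) , functionalCBIModel⇒abelianGroup
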